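{- Let $d\ge3$ and $c\ge1$ be integers, let $s=cd^2$, and let $I=(V,S,l)$ be an instance of \textsc{$s$-Dimensional Matching} with $n=|V|\equiv1\pmod d$. Let $I'$ be the instance of \textsc{$d$-Constraint-Cover} constructed from $I$ as described in the context. If $I$ is a positive instance, then $I'$ is a positive instance.
   Context: \textsc{$s$-Dimensional Matching}: an instance is $(V,S,l)$ with $V$ a finite set, $S\subseteq V^s$, $l$ a positive integer. Two tuples $t,t'\in V^r$ are orthogonal if $t[i]\neq t'[i]$ for every coordinate $i$; a matching is a set of pairwise orthogonal tuples; $I$ is positive if $S$ contains a matching of size $l$. \textsc{$d$-Constraint-Cover}: for a set $X$, a $0$-constraint is $(x=a)$ with $x\in X,a\in\{0,1\}$, $V((x=a))=\{x\}$; for $i>0$ an $i$-constraint is a set of $(i-1)$-constraints with pairwise disjoint variable sets, $V(C)$ being their union. $\mathcal{C}^0=\{(x=a):x\in X,a\in\{0,1\}\}$; $S\subseteq\mathcal{C}^0$ is an assignment if it contains exactly one $(x=a)$ for each $x$. An instance consists of a parameter $k$, a set $X$ of $d^2k$ variables, $\mathcal{C}^0$, a set $\mathcal{C}^1$ of $1$-constraints each with at most $d$ elements, and a set $\mathcal{C}^2$ of $2$-constraints each consisting of exactly $d$ elements of $\mathcal{C}^1$. A solution is an assignment $\mathcal{K}^0\subseteq\mathcal{C}^0$, $\mathcal{K}^1\subseteq\mathcal{C}^1$ with $|\mathcal{K}^1|=dk$, $\mathcal{K}^2\subseteq\mathcal{C}^2$ with $|\mathcal{K}^2|=k$, such that (i)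 $\bigcup_{C\in\mathcal{K}^1}C=\mathcal{K}^0$, (ii) $\bigcup_{C\in\mathcal{K}^2}C=\mathcal{K}^1$, (iii) every $C\in\mathcal{C}^1$ with $C\subseteq\mathcal{K}^0$ lies in $\mathcal{K}^1$; the instance is positive if a solution exists. Construction of $I'$: let $m=n^c$ and fix a bijection $\Phi:[0;m-1]\to V^c$. Set $k=dlm$. $X$ consists of the variables $x_{p,q,r,i,j}$ for $p\in[l]$, $q,r\in[d]$, $i\in[0;m-1]$, $j\in[d]$ (so $|X|=d^2k$). $\mathcal{C}^1$ and $\mathcal{C}^2$ consist exactly of the following constraints. (1) For $p\in[l]$, $q,r\in[d]$, distinct $i,i'\in[0;m-1]$, $j,j'\in[d]$: $C^1_{p,q,r,i,i',j,j'}=\{x_{p,q,r,i,j}=1,\ x_{p,q,r,i',j'}=1\}\in\mathcal{C}^1$. (2) For distinct $p,p'\in[l]$, $q,r\in[d]$, $i,i'\in[0;m-1]$ with $\Phi(i),\Phi(i')$ not orthogonal, $j,j'\in[d]$: $C^2_{p,p',q,r,i,i',j,j'}=\{x_{p,q,r,i,j}=1,\ x_{p',q,r,i',j'}=1\}\in\mathcal{C}^1$. (3) For $p\in[l]$, $q,r\in[d]$, $i\in[0;m-1]$: $C^3_{p,q,r,i}=\{x_{p,q,r,i,j}=0: j\in[d]\}\in\mathcal{C}^1$ and $C^4_{p,q,r,i}=\{C^3_{p,q,r,(i+z)\bmod m}:0\le z<d\}\in\mathcal{C}^2$. (4) For $p\in[l]$, $q\in[d]$, $t\in V^{cd}$,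 $j\in[d]$: writing $t$ as the concatenation $t_1\cdots t_d$ with $t_r\in V^c$ and $i_r=\Phi^{ -1}(t_r)$, $C^5_{p,q,t,j}=\{x_{p,q,r,i_r,j}=1: r\in[d]\}\in\mathcal{C}^1$. (5) For $p\in[l]$, $t\in S$, $j\in[d]$: writing $t$ as the concatenation $t_1\cdots t_d$ with $t_q\in V^{cd}$, $C^6_{p,t,j}=\{C^5_{p,q,t_q,j}:q\in[d]\}\in\mathcal{C}^2$. -}

module Defs where

open import Data.Nat using (ℕ; suc; _*_; _+_; _^_; _≤_)
open import Data.Nat.DivMod using (_mod_)
open import Data.Bool using (Bool; true; false)
open import Data.Fin using (Fin; toℕ)
open import Data.Vec using (Vec; lookup; concat) renaming (map to vmap)
open import Data.List using (List; []; _∷_; map; allFin; upTo)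
open import Data.List.Relation.Unary.Any using (Any)
open import Data.List.Membership.Propositional using (_∈_)
open import Data.Product using (Σ; _×_; _,_; ∃; ∃-syntax)
open import Data.Sum using (_⊎_)
open import Relation.Nullary using (¬_)
open import Relation.Binary.PropositionalEquality using (_≡_; _≢_)
open import Function.Bundles using (_⇔_; _↔_; Inverse)

Orthogonal : {n r : ℕ} → Vec (Fin n) r → Vec (Fin n) r → Set
Orthogonal t t′ = ∀ i → lookup t i ≢ lookup t′ i

-- V = Fin n, S ⊆ V^s given as a predicate.
-- I = (V,S,l) is positive iff S contains a matching of size l, i.e.
-- l tuples of S, indexed by Fin l, pairwise orthogonal (hence pairwise
-- distinct, so the matching has exactly l elements).

DMPositive : (n s : ℕ) → (Vec (Fin n) s → Set) → ℕ → Set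
DMPositive n s S l =
  Σ (Fin l → Vec (Fin n) s) λ M → ((∀ (p : Fin l) → S (M p)) ×
          (∀ p p′ → p ≢ p′ → Orthogonal {n} {s} (M p) (M p′)))

-- d-Constraint-Cover, over a variable type X.
-- 0-constraint (x = a) is the pair (x , a).
-- Finite sets are represented by lists, compared up to set equality.

Con0 : Set → Set
Con0 X = X × Bool

Con1 : Set → Set
Con1 X = List (Con0 X)

Con2 : Set → Set
Con2 X = List (Con1 X)

_≈₁_ : {X : Set} → Con1 X → Con1 X → Set
A ≈₁ B = ∀ c → (c ∈ A) ⇔ (c ∈ B)

_∈₁_ : {X : Set} → Con1 X → List (Con1 X) → Set
C ∈₁ L = Any (λ C′ → C′ ≈₁ C) L

_≈₂_ : {X : Set} → Con2 X → Con2 X → Set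
A ≈₂ B = ∀ C → (C ∈₁ A) ⇔ (C ∈₁ B)

-- A solution of the instance with parameters d, k, variables X,
-- 𝒞¹ (membership predicate on 1-constraints) and 𝒞² (membership predicate
-- on 2-constraints).  𝒦⁰ is an assignment X → Bool (the set of the (x = 𝒦⁰ x)),
-- 𝒦¹ / 𝒦² are sets of exactly dk / k pairwise distinct constraints.
record CCSolution (d k : ℕ) (X : Set) (𝒞¹ : Con1 X → Set) (𝒞² : Con2 X → Set) : Set where
  field
    K0 : X → Bool
    K1 : Fin (d * k) → Con1 X
    K2 : Fin k → Con2 X
    K1⊆𝒞¹ : ∀ i → 𝒞¹ (K1 i)
    K1-distinct : ∀ i j → K1 i ≈₁ K1 j → i ≡ j
    K2⊆𝒞² : ∀ i → 𝒞² (K2 i)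
    K2-distinct : ∀ i j → K2 i ≈₂ K2 j → i ≡ j
    -- (i)  ⋃ 𝒦¹ = 𝒦⁰
    cover0 : ∀ x a → (K0 x ≡ a) ⇔ (∃[ i ] ((x , a) ∈ K1 i))
    -- (ii) ⋃ 𝒦² = 𝒦¹
    cover1 : ∀ C → (∃[ j ] (C ∈₁ K2 j)) ⇔ (∃[ i ] (K1 i ≈₁ C))
    closed : ∀ C → 𝒞¹ C → (∀ x a → (x , a) ∈ C → K0 x ≡ a) → ∃[ i ] (K1 i ≈₁ C)

CCPositive : (d k : ℕ) (X : Set) → (Con1 X → Set) → (Con2 X → Set) → Set
CCPositive = CCSolution

addMod : {m : ℕ} → Fin m → ℕ → Fin m
addMod {suc m} i z = (toℕ i + z) mod (suc m)

module Construction (d c n l : ℕ)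
  (S : Vec (Fin n) (d * (d * c)) → Set)
  (Φ : Fin (n ^ c) ↔ Vec (Fin n) c) where

  m : ℕ
  m = n ^ c

  Φ⁻¹ : Vec (Fin n) c → Fin m
  Φ⁻¹ = Inverse.from Φ

  Φ′ : Fin m → Vec (Fin n) c
  Φ′ = Inverse.to Φ

  k : ℕ
  k = d * l * m

  X : Set
  X = Fin l × Fin d × Fin d × Fin m × Fin d

  x : Fin l → Fin d → Fin d → Fin m → Fin d → X
  x p q r i j = p , q , r , i , j

  C3 : Fin l → Fin d → Fin d → Fin m → Con1 X
  C3 p q r i = map (λ j → (x p q r i j , false)) (allFin d)

  C4 : Fin l → Fin d → Fin d → Fin m → Con2 X
  C4 p q r i = map (λ z → C3 p q r (addMod i z)) (upTo d)

  -- t ∈ V^{cd} written as the concatenation of its blocks ts = t₁ ⋯ t_d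
  C5 : Fin l → Fin d → Vec (Vec (Fin n) c) d → Fin d → Con1 X
  C5 p q ts j = map (λ r → (x p q r (Φ⁻¹ (lookup ts r)) j , true)) (allFin d)

  -- t ∈ V^s written as the concatenation t₁ ⋯ t_d, each t_q ∈ V^{cd}
  -- itself written as the concatenation of its blocks in V^c
  C6 : Fin l → Vec (Vec (Vec (Fin n) c) d) d → Fin d → Con2 X
  C6 p tss j = map (λ q → C5 p q (lookup tss q) j) (allFin d)

  𝒞¹ : Con1 X → Set
  𝒞¹ C =
      (∃[ p ] ∃[ q ] ∃[ r ] ∃[ i ] ∃[ i′ ] ∃[ j ] ∃[ j′ ]
         (i ≢ i′ × C ≈₁ ((x p q r i j , true) ∷ (x p q r i′ j′ , true) ∷ [])))
    ⊎ (∃[ p ] ∃[ p′ ] ∃[ q ] ∃[ r ] ∃[ i ] ∃[ i′ ] ∃[ j ] ∃[ j′ ]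
         (p ≢ p′ × ¬ Orthogonal (Φ′ i) (Φ′ i′) ×
          C ≈₁ ((x p q r i j , true) ∷ (x p′ q r i′ j′ , true) ∷ [])))
    ⊎ (∃[ p ] ∃[ q ] ∃[ r ] ∃[ i ] (C ≈₁ C3 p q r i))
    ⊎ (∃[ p ] ∃[ q ] ∃[ ts ] ∃[ j ] (C ≈₁ C5 p q ts j))

  𝒞² : Con2 X → Set
  𝒞² B =
      (∃[ p ] ∃[ q ] ∃[ r ] ∃[ i ] (B ≈₂ C4 p q r i))
    ⊎ (∃[ p ] ∃[ tss ] ∃[ j ] (S (concat (vmap concat tss)) × B ≈₂ C6 p tss j))

  I′Positive : Set
  I′Positive = CCPositive d k X 𝒞¹ 𝒞²

module Submission where

-- Split each tuple M p of a matching of size l into d² blocks in V^c and call the index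
-- Φ⁻¹ of the block (p, q, r) the chosen index of (p, q, r). The assignment sets x_{p,q,r,i,j}
-- exactly when i is chosen. Then 𝒦¹ consists of the C⁵ spelling out the blocks of the M p and
-- of the C³ at the unchosen indices, and 𝒦² of the C⁶ spelling out the M p together with C⁴
-- covering, for each (p, q, r), the m − 1 unchosen indices by runs of d cyclically consecutive
-- ones; these runs partition them because m = n^c ≡ 1 (mod d). No C¹ is satisfied since a
-- single index is chosen per (p, q, r), and no C² since distinct tuples of the matching, hence
-- their blocks, are orthogonal.

open import Defs
open import Data.Bool using (Bool; true; false)
open import Data.Empty using (⊥-elim)
open import Data.Fin using (Fin; toℕ; fromℕ<; combine; remQuot) renaming (zero to fzero)
open import Data.Fin.Properties
  using (toℕ<n; toℕ-fromℕ<; toℕ-injective; toℕ-combine; combine-remQuot;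
         remQuot-combine; *↔×; +↔⊎)
  renaming (_≟_ to _≟ᶠ_)
open import Data.List.Relation.Unary.Any using (here; there)
open import Data.List.Membership.Propositional using (_∈_; find; lose)
open import Data.List.Membership.Propositional.Properties
  using (∈-map⁺; ∈-map⁻; ∈-allFin; ∈-upTo⁺; ∈-upTo⁻)
open import Data.Nat using (ℕ; zero; suc; _+_; _*_; _∸_; _^_; _≤_; _<_; z≤n; s≤s; NonZero)
open import Data.Nat.DivMod using (_%_; %-distribˡ-+; m%n%n≡m%n; [m+n]%n≡m%n; m<n⇒m%n≡m; m%n<n)
open import Data.Nat.Properties using (+-identityʳ; +-assoc; +-comm; m+[n∸m]≡n; <⇒≤; ≤-pred; suc-injective)
open import Data.Nat.Tactic.RingSolver using (solve-∀)
open import Data.Product using (∃-syntax; _×_; _,_; proj₁; proj₂)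
open import Data.Product.Function.Dependent.Propositional using (Σ-⇔)
open import Data.Product.Function.NonDependent.Propositional using (_×-↔_)
open import Data.Sum using (_⊎_; inj₁; inj₂)
open import Data.Sum.Function.Propositional using (_⊎-↔_)
open import Data.Vec using (Vec; lookup; concat; group; tabulate) renaming (map to vmap)
open import Data.Vec.Properties
  using (lookup-concat; lookup-map; map-∘; map-cong; map-id; tabulate∘lookup; tabulate-cong)
open import Function.Base using (_∘_)
open import Function.Bundles using (_⇔_; _↔_; Inverse; Injection; Equivalence; mk⇔)
open import Function.Construct.Composition using (_⇔-∘_)
open import Function.Construct.Identity using (⇔-id)
open import Function.Construct.Symmetry using (⇔-sym)
open import Function.Properties.Inverse using (↔-refl; ↔-sym; ↔-trans; ↔⇒↣; ↔⇒↠)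
open import Relation.Nullary using (does; proof)
open import Relation.Nullary.Decidable using (dec-true; dec-false)
open import Relation.Nullary.Reflects using (Reflects; invert)
open import Relation.Binary.PropositionalEquality
  using (_≡_; _≢_; refl; sym; trans; cong; subst; subst₂; module ≡-Reasoning)

open ≡-Reasoning

[m%n+o]%n≡[m+o]%n : ∀ m o n .{{_ : NonZero n}} → (m % n + o) % n ≡ (m + o) % n
[m%n+o]%n≡[m+o]%n m o n = begin
  (m % n + o) % n          ≡⟨ %-distribˡ-+ (m % n) o n ⟩
  (m % n % n + o % n) % n  ≡⟨ cong (λ t → (t + o % n) % n) (m%n%n≡m%n m n) ⟩
  (m % n + o % n) % n      ≡⟨ %-distribˡ-+ m o n ⟨
  (m + o) % n              ∎

[m+o%n]%n≡[m+o]%n : ∀ m o n .{{_ : NonZero n}} → (m + o % n) % n ≡ (m + o) % n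
[m+o%n]%n≡[m+o]%n m o n = begin
  (m + o % n) % n  ≡⟨ cong (_% n) (+-comm m (o % n)) ⟩
  (o % n + m) % n  ≡⟨ [m%n+o]%n≡[m+o]%n o m n ⟩
  (o + m) % n      ≡⟨ cong (_% n) (+-comm o m) ⟩
  (m + o) % n      ∎

m<n⇒[m+n]%n≡m : ∀ {m n} .{{_ : NonZero n}} → m < n → (m + n) % n ≡ m
m<n⇒[m+n]%n≡m {m} {n} m<n = trans ([m+n]%n≡m%n m n) (m<n⇒m%n≡m m<n)

m+n+[o∸m]≡n+o : ∀ {m o} n → m ≤ o → m + n + (o ∸ m) ≡ n + o
m+n+[o∸m]≡n+o {m} {o} n m≤o = begin
  m + n + (o ∸ m)    ≡⟨ cong (_+ (o ∸ m)) (+-comm m n) ⟩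
  n + m + (o ∸ m)    ≡⟨ +-assoc n m (o ∸ m) ⟩
  n + (m + (o ∸ m))  ≡⟨ cong (n +_) (m+[n∸m]≡n m≤o) ⟩
  n + o              ∎

toℕ-addMod : ∀ {m} (i : Fin (suc m)) z → toℕ (addMod i z) ≡ (toℕ i + z) % suc m
toℕ-addMod i z = toℕ-fromℕ< _

addMod-identityʳ : ∀ {m} (i : Fin m) → addMod i 0 ≡ i
addMod-identityʳ {suc m} i = toℕ-injective (begin
  toℕ (addMod i 0)     ≡⟨ toℕ-addMod i 0 ⟩
  (toℕ i + 0) % suc m  ≡⟨ cong (_% suc m) (+-identityʳ (toℕ i)) ⟩
  toℕ i % suc m        ≡⟨ m<n⇒m%n≡m (toℕ<n i) ⟩
  toℕ i                ∎)

addMod-+ : ∀ {m} (i : Fin m) y z → addMod (addMod i y) z ≡ addMod i (y + z)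
addMod-+ {suc m} i y z = toℕ-injective (begin
  toℕ (addMod (addMod i y) z)          ≡⟨ toℕ-addMod (addMod i y) z ⟩
  (toℕ (addMod i y) + z) % suc m       ≡⟨ cong (λ t → (t + z) % suc m) (toℕ-addMod i y) ⟩
  ((toℕ i + y) % suc m + z) % suc m    ≡⟨ [m%n+o]%n≡[m+o]%n (toℕ i + y) z (suc m) ⟩
  (toℕ i + y + z) % suc m              ≡⟨ cong (_% suc m) (+-assoc (toℕ i) y z) ⟩
  (toℕ i + (y + z)) % suc m            ≡⟨ toℕ-addMod i (y + z) ⟨
  toℕ (addMod i (y + z))               ∎)

offset : ∀ {m} → Fin m → Fin m → ℕ
offset {suc m} i j = (toℕ j + (suc m ∸ toℕ i)) % suc m

offset<m : ∀ {m} (i j : Fin m) → offset i j < m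
offset<m {suc m} i j = m%n<n (toℕ j + (suc m ∸ toℕ i)) (suc m)

addMod-offset : ∀ {m} (i j : Fin m) → addMod i (offset i j) ≡ j
addMod-offset {suc m} i j = toℕ-injective (begin
  toℕ (addMod i (offset i j))                         ≡⟨ toℕ-addMod i _ ⟩
  (toℕ i + (toℕ j + (suc m ∸ toℕ i)) % suc m) % suc m  ≡⟨ [m+o%n]%n≡[m+o]%n (toℕ i) _ (suc m) ⟩
  (toℕ i + (toℕ j + (suc m ∸ toℕ i))) % suc m         ≡⟨ cong (_% suc m) (+-assoc (toℕ i) _ _) ⟨
  (toℕ i + toℕ j + (suc m ∸ toℕ i)) % suc m           ≡⟨ cong (_% suc m) (m+n+[o∸m]≡n+o _ (<⇒≤ (toℕ<n i))) ⟩
  (toℕ j + suc m) % suc m                             ≡⟨ m<n⇒[m+n]%n≡m (toℕ<n j) ⟩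
  toℕ j                                               ∎)

offset-addMod : ∀ {m} (i : Fin m) {z} → z < m → offset i (addMod i z) ≡ z
offset-addMod {suc m} i {z} z<m = begin
  (toℕ (addMod i z) + (suc m ∸ toℕ i)) % suc m    ≡⟨ cong (λ t → (t + (suc m ∸ toℕ i)) % suc m) (toℕ-addMod i z) ⟩
  ((toℕ i + z) % suc m + (suc m ∸ toℕ i)) % suc m  ≡⟨ [m%n+o]%n≡[m+o]%n (toℕ i + z) _ (suc m) ⟩
  (toℕ i + z + (suc m ∸ toℕ i)) % suc m           ≡⟨ cong (_% suc m) (m+n+[o∸m]≡n+o z (<⇒≤ (toℕ<n i))) ⟩
  (z + suc m) % suc m                             ≡⟨ m<n⇒[m+n]%n≡m z<m ⟩
  z                                               ∎

addMod-injective : ∀ {m} (i : Fin m) {y z} → y < m → z < m → addMod i y ≡ addMod i z → y ≡ z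
addMod-injective i {y} {z} y<m z<m eq = begin
  y                    ≡⟨ offset-addMod i y<m ⟨
  offset i (addMod i y) ≡⟨ cong (offset i) eq ⟩
  offset i (addMod i z) ≡⟨ offset-addMod i z<m ⟩
  z                    ∎

shift : ∀ {m N} → Fin m → Fin N → Fin m
shift i e = addMod i (suc (toℕ e))

module _ {m N : ℕ} (m≡1+N : m ≡ suc N) (i : Fin m) where

  private
    1+e<m : (e : Fin N) → suc (toℕ e) < m
    1+e<m e = subst (suc (toℕ e) <_) (sym m≡1+N) (s≤s (toℕ<n e))

    0<m : 0 < m
    0<m = subst (0 <_) (sym m≡1+N) (s≤s z≤n)

  shift-injective : ∀ {e e′} → shift i e ≡ shift i e′ → e ≡ e′
  shift-injective eq = toℕ-injective (suc-injective (addMod-injective i (1+e<m _) (1+e<m _) eq))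

  shift≢ : ∀ e → shift i e ≢ i
  shift≢ e eq with () ← addMod-injective i (1+e<m e) 0<m (trans eq (sym (addMod-identityʳ i)))

  shift-surjective : ∀ {j} → j ≢ i → ∃[ e ] (shift i e ≡ j)
  shift-surjective {j} j≢i with offset i j | offset<m i j | addMod-offset i j
  ... | zero  | _       | i≡j = ⊥-elim (j≢i (trans (sym i≡j) (addMod-identityʳ i)))
  ... | suc o | 1+o<m | eq  = fromℕ< o<N , trans (cong (λ t → addMod i (suc t)) (toℕ-fromℕ< o<N)) eq
    where
    o<N : o < N
    o<N = ≤-pred (subst (suc o <_) m≡1+N 1+o<m)

addMod-shift-combine : ∀ {m b d} (i : Fin m) (β : Fin b) (z : Fin (suc d)) →
                       addMod (shift i (combine β (fzero {n = d}))) (toℕ z) ≡ shift i (combine β z)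
addMod-shift-combine {d = d} i β z =
  trans (addMod-+ i _ (toℕ z)) (cong (λ t → addMod i (suc t)) combine-offset)
  where
  combine-offset : toℕ (combine β fzero) + toℕ z ≡ toℕ (combine β z)
  combine-offset = begin
    toℕ (combine β fzero) + toℕ z  ≡⟨ cong (_+ toℕ z) (trans (toℕ-combine β fzero) (+-identityʳ _)) ⟩
    suc d * toℕ β + toℕ z          ≡⟨ toℕ-combine β z ⟨
    toℕ (combine β z)              ∎

[1+a*d]^c≡1+b*d : ∀ a d c → ∃[ b ] ((1 + a * d) ^ c ≡ 1 + b * d)
[1+a*d]^c≡1+b*d a d zero    = 0 , refl
[1+a*d]^c≡1+b*d a d (suc c) with b , eq ← [1+a*d]^c≡1+b*d a d c =
  a + b + a * b * d , trans (cong ((1 + a * d) *_) eq) (product a b d)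
  where
  product : ∀ a b d → (1 + a * d) * (1 + b * d) ≡ 1 + (a + b + a * b * d) * d
  product = solve-∀

blocks² : ∀ {A : Set} d c → Vec A (d * (d * c)) → Vec (Vec (Vec A c) d) d
blocks² d c v = vmap (λ w → proj₁ (group d c w)) (proj₁ (group d (d * c) v))

concat²-blocks² : ∀ {A : Set} d c (v : Vec A (d * (d * c))) → concat (vmap concat (blocks² d c v)) ≡ v
concat²-blocks² d c v = begin
  concat (vmap concat (vmap (λ w → proj₁ (group d c w)) vss))
    ≡⟨ cong concat (map-∘ concat _ vss) ⟨
  concat (vmap (λ w → concat (proj₁ (group d c w))) vss)
    ≡⟨ cong concat (map-cong (λ w → sym (proj₂ (group d c w))) vss) ⟩
  concat (vmap (λ w → w) vss)
    ≡⟨ cong concat (map-id vss) ⟩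
  concat vss
    ≡⟨ proj₂ (group d (d * c) v) ⟨
  v ∎
  where
  vss = proj₁ (group d (d * c) v)

lookup-ext : ∀ {A : Set} {n} {xs ys : Vec A n} → (∀ i → lookup xs i ≡ lookup ys i) → xs ≡ ys
lookup-ext {xs = xs} {ys} eq = begin
  xs                  ≡⟨ tabulate∘lookup xs ⟨
  tabulate (lookup xs) ≡⟨ tabulate-cong eq ⟩
  tabulate (lookup ys) ≡⟨ tabulate∘lookup ys ⟩
  ys                  ∎

Orthogonal-concat⁻ : ∀ {n a b} (xss yss : Vec (Vec (Fin n) a) b) → Orthogonal (concat xss) (concat yss) →
                    ∀ q → Orthogonal (lookup xss q) (lookup yss q)
Orthogonal-concat⁻ xss yss orth q w eq =
  orth (combine q w) (trans (lookup-concat xss q w) (trans eq (sym (lookup-concat yss q w))))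

Orthogonal-blocks² : ∀ {n} d c {v w : Vec (Fin n) (d * (d * c))} → Orthogonal v w →
                     ∀ q r → Orthogonal (lookup (lookup (blocks² d c v) q) r) (lookup (lookup (blocks² d c w) q) r)
Orthogonal-blocks² d c {v} {w} orth q = Orthogonal-concat⁻ (lookup vss q) (lookup wss q) orth-q
  where
  vss = blocks² d c v
  wss = blocks² d c w
  orth-q : Orthogonal (concat (lookup vss q)) (concat (lookup wss q))
  orth-q = subst₂ Orthogonal (lookup-map q concat vss) (lookup-map q concat wss)
             (Orthogonal-concat⁻ (vmap concat vss) (vmap concat wss)
               (subst₂ Orthogonal (sym (concat²-blocks² d c v)) (sym (concat²-blocks² d c w)) orth) q)

≈₁-refl : ∀ {X : Set} {C : Con1 X} → C ≈₁ C
≈₁-refl _ = ⇔-id _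

≈₁-sym : ∀ {X : Set} {A B : Con1 X} → A ≈₁ B → B ≈₁ A
≈₁-sym A≈B y = ⇔-sym (A≈B y)

≈₁-∈ : ∀ {X : Set} {A B : Con1 X} {y} → A ≈₁ B → y ∈ A → y ∈ B
≈₁-∈ A≈B = Equivalence.to (A≈B _)

≈₂-refl : ∀ {X : Set} {B : Con2 X} → B ≈₂ B
≈₂-refl _ = ⇔-id _

∃-reindex : ∀ {A T : Set} (e : A ↔ T) {P : T → Set} → (∃[ a ] P (Inverse.to e a)) ⇔ (∃[ t ] P t)
∃-reindex e = Σ-⇔ (↔⇒↠ e) (⇔-id _)

record IndexedCCSolution (X : Set) (𝒞¹ : Con1 X → Set) (𝒞² : Con2 X → Set) (T₁ T₂ : Set) : Set where
  field
    K0 : X → Bool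
    K1 : T₁ → Con1 X
    K2 : T₂ → Con2 X
    K1⊆𝒞¹ : ∀ t → 𝒞¹ (K1 t)
    K1-injective : ∀ t t′ → K1 t ≈₁ K1 t′ → t ≡ t′
    K2⊆𝒞² : ∀ t → 𝒞² (K2 t)
    K2-injective : ∀ t t′ → K2 t ≈₂ K2 t′ → t ≡ t′
    cover0 : ∀ y a → (K0 y ≡ a) ⇔ (∃[ t ] ((y , a) ∈ K1 t))
    cover1 : ∀ C → (∃[ t ] (C ∈₁ K2 t)) ⇔ (∃[ t ] (K1 t ≈₁ C))
    closed : ∀ C → 𝒞¹ C → (∀ y a → (y , a) ∈ C → K0 y ≡ a) → ∃[ t ] (K1 t ≈₁ C)

IndexedCCSolution⇒CCSolution : ∀ {d k X 𝒞¹ 𝒞² T₁ T₂} → Fin (d * k) ↔ T₁ → Fin k ↔ T₂ →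
                               IndexedCCSolution X 𝒞¹ 𝒞² T₁ T₂ → CCSolution d k X 𝒞¹ 𝒞²
IndexedCCSolution⇒CCSolution e₁ e₂ sol = record
  { K0 = K0
  ; K1 = K1 ∘ Inverse.to e₁
  ; K2 = K2 ∘ Inverse.to e₂
  ; K1⊆𝒞¹ = K1⊆𝒞¹ ∘ Inverse.to e₁
  ; K1-distinct = λ i j eq → Injection.injective (↔⇒↣ e₁) (K1-injective _ _ eq)
  ; K2⊆𝒞² = K2⊆𝒞² ∘ Inverse.to e₂
  ; K2-distinct = λ i j eq → Injection.injective (↔⇒↣ e₂) (K2-injective _ _ eq)
  ; cover0 = λ y a → ⇔-sym (∃-reindex e₁) ⇔-∘ cover0 y a
  ; cover1 = λ C → ⇔-sym (∃-reindex e₁) ⇔-∘ (cover1 C ⇔-∘ ∃-reindex e₂)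
  ; closed = λ C C∈𝒞¹ C⊆K0 → Equivalence.from (∃-reindex e₁) (closed C C∈𝒞¹ C⊆K0)
  }
  where open IndexedCCSolution sol

*↔×³ : ∀ {a b c} → Fin (a * (b * c)) ↔ (Fin a × Fin b × Fin c)
*↔×³ = ↔-trans *↔× (↔-refl ×-↔ *↔×)

*↔×⁴ : ∀ {a b c e} → Fin (a * (b * (c * e))) ↔ (Fin a × Fin b × Fin c × Fin e)
*↔×⁴ = ↔-trans *↔× (↔-refl ×-↔ *↔×³)

module FromMatching
  (d₀ c n l : ℕ)
  (S : Vec (Fin n) (suc d₀ * (suc d₀ * c)) → Set)
  (Φ : Fin (n ^ c) ↔ Vec (Fin n) c)
  (b : ℕ) (m≡1+bd : n ^ c ≡ suc (b * suc d₀))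
  (M : Fin l → Vec (Fin n) (suc d₀ * (suc d₀ * c)))
  (M⊆S : ∀ p → S (M p))
  (M-orthogonal : ∀ p p′ → p ≢ p′ → Orthogonal (M p) (M p′))
  where

  d : ℕ
  d = suc d₀

  open Construction d c n l S Φ

  blocks : Fin l → Vec (Vec (Vec (Fin n) c) d) d
  blocks p = blocks² d c (M p)

  chosen : Fin l → Fin d → Fin d → Fin m
  chosen p q r = Φ⁻¹ (lookup (lookup (blocks p) q) r)

  chosen-orthogonal : ∀ {p p′} q r → p ≢ p′ → Orthogonal (Φ′ (chosen p q r)) (Φ′ (chosen p′ q r))
  chosen-orthogonal q r p≢p′ =
    subst₂ Orthogonal (sym (Inverse.strictlyInverseˡ Φ _)) (sym (Inverse.strictlyInverseˡ Φ _))
      (Orthogonal-blocks² d c (M-orthogonal _ _ p≢p′) q r)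

  Φ⁻¹-injective : ∀ {u v} → Φ⁻¹ u ≡ Φ⁻¹ v → u ≡ v
  Φ⁻¹-injective = Injection.injective (↔⇒↣ (↔-sym Φ))

  -- The m − 1 = b d unchosen indices of (p, q, r), numbered by their cyclic distance from the
  -- chosen one minus 1; the C⁴ of run β covers the numbers combine β z = d β + z.
  unchosen : Fin l → Fin d → Fin d → Fin (b * d) → Fin m
  unchosen p q r = shift (chosen p q r)

  x-injective : ∀ {p q r i j a p′ q′ r′ i′ j′ a′} →
                _≡_ {A = Con0 X} (x p q r i j , a) (x p′ q′ r′ i′ j′ , a′) →
                p ≡ p′ × q ≡ q′ × r ≡ r′ × i ≡ i′ × j ≡ j′ × a ≡ a′
  x-injective refl = refl , refl , refl , refl , refl , refl

  ∈-C3⁺ : ∀ {p q r i} j → (x p q r i j , false) ∈ C3 p q r i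
  ∈-C3⁺ j = ∈-map⁺ _ (∈-allFin j)

  ∈-C3⁻ : ∀ {p q r i y} → y ∈ C3 p q r i → ∃[ j ] (y ≡ (x p q r i j , false))
  ∈-C3⁻ y∈ with j , _ , eq ← ∈-map⁻ _ y∈ = j , eq

  ∈-C5⁺ : ∀ {p q ts j} r → (x p q r (Φ⁻¹ (lookup ts r)) j , true) ∈ C5 p q ts j
  ∈-C5⁺ r = ∈-map⁺ _ (∈-allFin r)

  ∈-C5⁻ : ∀ {p q ts j y} → y ∈ C5 p q ts j → ∃[ r ] (y ≡ (x p q r (Φ⁻¹ (lookup ts r)) j , true))
  ∈-C5⁻ y∈ with r , _ , eq ← ∈-map⁻ _ y∈ = r , eq

  ∈-C4⁺ : ∀ {p q r i} (z : Fin d) → C3 p q r (addMod i (toℕ z)) ∈ C4 p q r i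
  ∈-C4⁺ z = ∈-map⁺ _ (∈-upTo⁺ (toℕ<n z))

  ∈-C4⁻ : ∀ {p q r i C} → C ∈ C4 p q r i → ∃[ z ] (C ≡ C3 p q r (addMod i (toℕ {d} z)))
  ∈-C4⁻ {p} {q} {r} {i} C∈ with z , z∈ , refl ← ∈-map⁻ _ C∈ =
    fromℕ< (∈-upTo⁻ z∈) , cong (λ t → C3 p q r (addMod i t)) (sym (toℕ-fromℕ< _))

  ∈-C6⁺ : ∀ {p tss j} q → C5 p q (lookup tss q) j ∈ C6 p tss j
  ∈-C6⁺ q = ∈-map⁺ _ (∈-allFin q)

  ∈-C6⁻ : ∀ {p tss j C} → C ∈ C6 p tss j → ∃[ q ] (C ≡ C5 p q (lookup tss q) j)
  ∈-C6⁻ C∈ with q , _ , eq ← ∈-map⁻ _ C∈ = q , eq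

  K0 : X → Bool
  K0 (p , q , r , i , j) = does (i ≟ᶠ chosen p q r)

  K0-true : ∀ {p q r i j} → K0 (x p q r i j) ≡ true → i ≡ chosen p q r
  K0-true {p} {q} {r} {i} eq = invert (subst (Reflects _) eq (proof (i ≟ᶠ chosen p q r)))

  K0-false : ∀ {p q r i j} → K0 (x p q r i j) ≡ false → i ≢ chosen p q r
  K0-false {p} {q} {r} {i} eq = invert (subst (Reflects _) eq (proof (i ≟ᶠ chosen p q r)))

  Satisfied : Con1 X → Set
  Satisfied C = ∀ y a → (y , a) ∈ C → K0 y ≡ a

  Satisfied-≈ : ∀ {A B} → A ≈₁ B → Satisfied A → Satisfied B
  Satisfied-≈ A≈B sat y a y∈ = sat y a (≈₁-∈ (≈₁-sym A≈B) y∈)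

  Satisfied-true : ∀ {C p q r i j} → Satisfied C → (x p q r i j , true) ∈ C → i ≡ chosen p q r
  Satisfied-true {_} {p} {q} {r} {i} {j} sat y∈ = K0-true {p} {q} {r} {i} {j} (sat _ _ y∈)

  Satisfied-false : ∀ {C p q r i j} → Satisfied C → (x p q r i j , false) ∈ C → i ≢ chosen p q r
  Satisfied-false {_} {p} {q} {r} {i} {j} sat y∈ = K0-false {p} {q} {r} {i} {j} (sat _ _ y∈)

  T₁ : Set
  T₁ = (Fin l × Fin d × Fin d) ⊎ (Fin l × Fin d × Fin d × Fin (b * d))

  K1 : T₁ → Con1 X
  K1 (inj₁ (p , q , j))     = C5 p q (lookup (blocks p) q) j
  K1 (inj₂ (p , q , r , e)) = C3 p q r (unchosen p q r e)

  K1⊆𝒞¹ : ∀ t → 𝒞¹ (K1 t)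
  K1⊆𝒞¹ (inj₁ (p , q , j))     = inj₂ (inj₂ (inj₂ (p , q , lookup (blocks p) q , j , ≈₁-refl)))
  K1⊆𝒞¹ (inj₂ (p , q , r , e)) = inj₂ (inj₂ (inj₁ (p , q , r , unchosen p q r e , ≈₁-refl)))

  K1-injective : ∀ t t′ → K1 t ≈₁ K1 t′ → t ≡ t′
  K1-injective (inj₁ (p , q , _)) (inj₁ (p′ , q′ , _)) K≈
    with _ , eq ← ∈-C5⁻ {ts = lookup (blocks p′) q′}
                    (≈₁-∈ K≈ (∈-C5⁺ {ts = lookup (blocks p) q} fzero))
    with refl , refl , _ , _ , refl , _ ← x-injective eq = refl
  K1-injective (inj₁ (p , q , _)) (inj₂ _) K≈
    with _ , eq ← ∈-C3⁻ (≈₁-∈ K≈ (∈-C5⁺ {ts = lookup (blocks p) q} fzero))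
    with _ , _ , _ , _ , _ , () ← x-injective eq
  K1-injective (inj₂ _) (inj₁ (p′ , q′ , _)) K≈
    with _ , eq ← ∈-C5⁻ {ts = lookup (blocks p′) q′} (≈₁-∈ K≈ (∈-C3⁺ fzero))
    with _ , _ , _ , _ , _ , () ← x-injective eq
  K1-injective (inj₂ (p , q , r , _)) (inj₂ _) K≈
    with _ , eq ← ∈-C3⁻ (≈₁-∈ K≈ (∈-C3⁺ fzero))
    with refl , refl , refl , unchosen≡ , _ ← x-injective eq =
    cong (λ e → inj₂ (p , q , r , e)) (shift-injective m≡1+bd (chosen p q r) unchosen≡)

  T₂ : Set
  T₂ = (Fin l × Fin d) ⊎ (Fin l × Fin d × Fin d × Fin b)

  runStart : Fin l → Fin d → Fin d → Fin b → Fin m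
  runStart p q r β = unchosen p q r (combine β fzero)

  K2 : T₂ → Con2 X
  K2 (inj₁ (p , j))         = C6 p (blocks p) j
  K2 (inj₂ (p , q , r , β)) = C4 p q r (runStart p q r β)

  K2⊆𝒞² : ∀ t → 𝒞² (K2 t)
  K2⊆𝒞² (inj₁ (p , j)) =
    inj₂ (p , blocks p , j , subst S (sym (concat²-blocks² d c (M p))) (M⊆S p) , ≈₂-refl)
  K2⊆𝒞² (inj₂ (p , q , r , β)) = inj₁ (p , q , r , runStart p q r β , ≈₂-refl)

  owner : T₁ → T₂
  owner (inj₁ (p , q , j))     = inj₁ (p , j)
  owner (inj₂ (p , q , r , e)) = inj₂ (p , q , r , proj₁ (remQuot {b} d e))

  leader : T₂ → T₁
  leader (inj₁ (p , j))         = inj₁ (p , fzero , j)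
  leader (inj₂ (p , q , r , β)) = inj₂ (p , q , r , combine β fzero)

  owner-combine : ∀ p q r β z → owner (inj₂ (p , q , r , combine β z)) ≡ inj₂ (p , q , r , β)
  owner-combine p q r β z = cong (λ β′ → inj₂ (p , q , r , β′)) (cong proj₁ (remQuot-combine β z))

  owner-leader : ∀ t → owner (leader t) ≡ t
  owner-leader (inj₁ _)               = refl
  owner-leader (inj₂ (p , q , r , β)) = owner-combine p q r β fzero

  K1∈K2-owner : ∀ t → K1 t ∈ K2 (owner t)
  K1∈K2-owner (inj₁ (p , q , j))     = ∈-C6⁺ {tss = blocks p} q
  K1∈K2-owner (inj₂ (p , q , r , e)) =
    subst (λ i → C3 p q r i ∈ K2 (owner (inj₂ (p , q , r , e)))) owner-position (∈-C4⁺ z)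
    where
    β : Fin b
    β = proj₁ (remQuot {b} d e)
    z : Fin d
    z = proj₂ (remQuot {b} d e)
    owner-position : addMod (runStart p q r β) (toℕ z) ≡ unchosen p q r e
    owner-position = trans (addMod-shift-combine (chosen p q r) β z) (cong (unchosen p q r) (combine-remQuot {b} d e))

  K2-members : ∀ {C} t → C ∈ K2 t → ∃[ t₁ ] (owner t₁ ≡ t × C ≡ K1 t₁)
  K2-members (inj₁ (p , j)) C∈ with q , refl ← ∈-C6⁻ {tss = blocks p} C∈ = inj₁ (p , q , j) , refl , refl
  K2-members (inj₂ (p , q , r , β)) C∈ with z , refl ← ∈-C4⁻ C∈ =
    inj₂ (p , q , r , combine β z) , owner-combine p q r β z ,
    cong (C3 p q r) (addMod-shift-combine (chosen p q r) β z)

  K1-leader∈K2 : ∀ t → K1 (leader t) ∈ K2 t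
  K1-leader∈K2 t = subst (λ t′ → K1 (leader t) ∈ K2 t′) (owner-leader t) (K1∈K2-owner (leader t))

  K2-injective : ∀ t t′ → K2 t ≈₂ K2 t′ → t ≡ t′
  K2-injective t t′ K≈
    with C , C∈ , C≈ ← find (Equivalence.to (K≈ _) (lose (K1-leader∈K2 t) ≈₁-refl))
    with t₁ , refl , refl ← K2-members t′ C∈ = begin
      t              ≡⟨ owner-leader t ⟨
      owner (leader t) ≡⟨ cong owner (K1-injective t₁ (leader t) C≈) ⟨
      owner t₁         ∎

  K0-covered : ∀ y a → K0 y ≡ a → ∃[ t ] ((y , a) ∈ K1 t)
  K0-covered (p , q , r , i , j) true K0≡a
    with refl ← K0-true {p} {q} {r} {i} {j} K0≡a =
    inj₁ (p , q , j) , ∈-C5⁺ {ts = lookup (blocks p) q} r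
  K0-covered (p , q , r , i , j) false K0≡a
    with e , refl ← shift-surjective m≡1+bd (chosen p q r) (K0-false {p} {q} {r} {i} {j} K0≡a) =
    inj₂ (p , q , r , e) , ∈-C3⁺ j

  K1-satisfied : ∀ t → Satisfied (K1 t)
  K1-satisfied (inj₁ (p , q , j)) y a y∈ with r , refl ← ∈-C5⁻ {ts = lookup (blocks p) q} y∈ =
    dec-true (chosen p q r ≟ᶠ chosen p q r) refl
  K1-satisfied (inj₂ (p , q , r , e)) y a y∈ with _ , refl ← ∈-C3⁻ y∈ =
    dec-false (unchosen p q r e ≟ᶠ chosen p q r) (shift≢ m≡1+bd (chosen p q r) e)

  cover0 : ∀ y a → (K0 y ≡ a) ⇔ (∃[ t ] ((y , a) ∈ K1 t))
  cover0 y a = mk⇔ (K0-covered y a) λ (t , y∈) → K1-satisfied t y a y∈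

  cover1 : ∀ C → (∃[ t ] (C ∈₁ K2 t)) ⇔ (∃[ t ] (K1 t ≈₁ C))
  cover1 C = mk⇔ member-of-K2 λ (t₁ , K≈) → owner t₁ , lose (K1∈K2-owner t₁) K≈
    where
    member-of-K2 : ∃[ t ] (C ∈₁ K2 t) → ∃[ t ] (K1 t ≈₁ C)
    member-of-K2 (t , C∈₁)
      with C′ , C′∈ , C′≈ ← find C∈₁
      with t₁ , _ , refl ← K2-members t C′∈ = t₁ , C′≈

  closed : ∀ C → 𝒞¹ C → Satisfied C → ∃[ t ] (K1 t ≈₁ C)
  closed C (inj₁ (p , q , r , i , i′ , j , j′ , i≢i′ , C≈)) sat
    with refl ← Satisfied-true (Satisfied-≈ C≈ sat) (here refl)
    with refl ← Satisfied-true (Satisfied-≈ C≈ sat) (there (here refl)) = ⊥-elim (i≢i′ refl)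
  closed C (inj₂ (inj₁ (p , p′ , q , r , i , i′ , j , j′ , p≢p′ , non-orthogonal , C≈))) sat
    with refl ← Satisfied-true (Satisfied-≈ C≈ sat) (here refl)
    with refl ← Satisfied-true (Satisfied-≈ C≈ sat) (there (here refl)) =
    ⊥-elim (non-orthogonal (chosen-orthogonal q r p≢p′))
  closed C (inj₂ (inj₂ (inj₁ (p , q , r , i , C≈)))) sat
    with e , refl ← shift-surjective m≡1+bd (chosen p q r)
                      (Satisfied-false (Satisfied-≈ C≈ sat) (∈-C3⁺ fzero)) =
    inj₂ (p , q , r , e) , ≈₁-sym C≈
  closed C (inj₂ (inj₂ (inj₂ (p , q , ts , j , C≈)))) sat
    with refl ← lookup-ext {xs = ts} {ys = lookup (blocks p) q}
                  (λ r → Φ⁻¹-injective (Satisfied-true (Satisfied-≈ C≈ sat) (∈-C5⁺ {ts = ts} r))) =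
    inj₁ (p , q , j) , ≈₁-sym C≈

  Fin-dk↔T₁ : Fin (d * k) ↔ T₁
  Fin-dk↔T₁ = subst (λ N → Fin N ↔ T₁) (sym card) (↔-trans +↔⊎ (*↔×³ ⊎-↔ *↔×⁴))
    where
    card : d * k ≡ l * (d * d) + l * (d * (d * (b * d)))
    card = trans (cong (λ m′ → d * (d * l * m′)) m≡1+bd) (count d l b)
      where
      count : ∀ d l b → d * (d * l * suc (b * d)) ≡ l * (d * d) + l * (d * (d * (b * d)))
      count = solve-∀

  Fin-k↔T₂ : Fin k ↔ T₂
  Fin-k↔T₂ = subst (λ N → Fin N ↔ T₂) (sym card) (↔-trans +↔⊎ (*↔× ⊎-↔ *↔×⁴))
    where
    card : k ≡ l * d + l * (d * (d * b))
    card = trans (cong (λ m′ → d * l * m′) m≡1+bd) (count d l b)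
      where
      count : ∀ d l b → d * l * suc (b * d) ≡ l * d + l * (d * (d * b))
      count = solve-∀

  I′-positive : I′Positive
  I′-positive = IndexedCCSolution⇒CCSolution Fin-dk↔T₁ Fin-k↔T₂ record
    { K0 = K0 ; K1 = K1 ; K2 = K2
    ; K1⊆𝒞¹ = K1⊆𝒞¹ ; K1-injective = K1-injective
    ; K2⊆𝒞² = K2⊆𝒞² ; K2-injective = K2-injective
    ; cover0 = cover0 ; cover1 = cover1 ; closed = closed
    }

lemma9 : (d c : ℕ) → 3 ≤ d → 1 ≤ c →
         (n : ℕ) → (∃[ a ] (n ≡ 1 + a * d)) →
         (S : Vec (Fin n) (d * (d * c)) → Set) → (l : ℕ) → 1 ≤ l →
         (Φ : Fin (n ^ c) ↔ Vec (Fin n) c) →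
         DMPositive n (d * (d * c)) S l →
         Construction.I′Positive d c n l S Φ
lemma9 (suc d₀) c _ _ n (a , refl) S l _ Φ (M , M⊆S , M-orthogonal)
  with b , m≡1+bd ← [1+a*d]^c≡1+b*d a (suc d₀) c =
  FromMatching.I′-positive d₀ c n l S Φ b m≡1+bd M M⊆S M-orthogonal
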